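{- Let $E$ be a nonempty finite set and let $\mathcal{I},\mathcal{I}'\subseteq 2^E$ be constructible families such that the set of inclusion-maximal members of $\mathcal{I}$ equals the set of inclusion-maximal members of $\mathcal{I}'$. Then the rank function $\rho'$ of $\mathcal{I}'$ coincides with the rank function $\rho$ of $\mathcal{I}$.
   Context: For a family $\mathcal{I}\subseteq 2^E$ and $I \in \mathcal{I}$, $\mathrm{ex}_{\mathcal{I}}(I):=\{e \in I \mid I\setminus\{e\} \in \mathcal{I}\}$. A nonempty family $\mathcal{I}\subseteq 2^E$ is constructible if $\mathrm{ex}_{\mathcal{I}}(I)\neq\emptyset$ for all $I \in \mathcal{I}\setminus\{\emptyset\}$. The rank function of a constructible family $\mathcal{I}$ is $\rho(X)=\max_{I\in\mathcal{I}}|X\cap I|$ for $X\subseteq E$. -}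

module Defs where

open import Data.Nat using (ℕ; zero; suc; _⊔_)
open import Data.Bool using (Bool; true; false; if_then_else_)
open import Data.List using (List; []; _∷_; _++_; map; foldr)
open import Data.Vec using ([]; _∷_)
open import Data.Fin.Subset using (Subset; _∈_; _⊆_; _∩_; _-_; ∣_∣; ⊥)
open import Data.Product using (Σ; ∃; ∃-syntax; _×_)
open import Relation.Binary.PropositionalEquality using (_≡_; _≢_)

-- A family 𝓘 ⊆ 2^E, E = Fin n, given by its (decidable) characteristic function.
Family : ℕ → Set
Family n = Subset n → Bool

_∈F_ : ∀ {n} → Subset n → Family n → Set
I ∈F 𝓘 = 𝓘 I ≡ true

ExNonempty : ∀ {n} → Family n → Subset n → Set
ExNonempty 𝓘 I = ∃[ e ] (e ∈ I × (I - e) ∈F 𝓘)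

Constructible : ∀ {n} → Family n → Set
Constructible 𝓘 =
  (∃[ I ] I ∈F 𝓘) × (∀ I → I ∈F 𝓘 → I ≢ ⊥ → ExNonempty 𝓘 I)

Maximal : ∀ {n} → Family n → Subset n → Set
Maximal 𝓘 I = I ∈F 𝓘 × (∀ J → J ∈F 𝓘 → I ⊆ J → J ≡ I)

allSubsets : ∀ n → List (Subset n)
allSubsets zero = [] ∷ []
allSubsets (suc n) = map (true ∷_) (allSubsets n) ++ map (false ∷_) (allSubsets n)

-- rank function ρ(X) = max_{I ∈ 𝓘} |X ∩ I|  (0 if 𝓘 were empty; constructible families are nonempty)
rank : ∀ {n} → Family n → Subset n → ℕ
rank {n} 𝓘 X = foldr (λ I m → if 𝓘 I then ∣ X ∩ I ∣ ⊔ m else m) 0 (allSubsets n)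

-- The rank of a family is attained on its inclusion-maximal members: ∣ X ∩ I ∣ only grows
-- when I is enlarged, and in a finite family every member lies below a maximal one
-- (grow it along ⊂, which is well founded on subsets of a finite set).  Hence ρ depends
-- only on the maximal members, and two families with the same maximal members have the
-- same rank function.
module Submission where

open import Defs
open import Data.Nat using (ℕ; suc; _⊔_; _≤_; z≤n)
open import Data.Nat.Properties using (≤-trans; ≤-antisym; m≤m⊔n; m≤n⊔m; ⊔-lub)
open import Data.Bool using (true; false; if_then_else_; _≟_)
open import Data.Vec using ([]; _∷_)
open import Data.Fin.Subset using (Subset; _⊆_; _⊂_; _⊃_; _∩_; ∣_∣)
open import Data.Fin.Subset.Properties
  using (_∈?_; _⊂?_; ⊆-antisym; ⊆-refl; ⊆-trans; p⊂q⇒p⊆q; p⊆q⇒∣p∣≤∣q∣; x∈p∩q⁺; x∈p∩q⁻; anySubset?)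
open import Data.Fin.Subset.Induction using (⊃-wellFounded)
open import Data.List using (List; []; _∷_; map; foldr)
open import Data.List.Membership.Propositional using () renaming (_∈_ to _∈ᴸ_)
open import Data.List.Membership.Propositional.Properties using (∈-map⁺; ∈-++⁺ˡ; ∈-++⁺ʳ)
open import Data.List.Relation.Unary.Any using (here; there)
open import Data.Product using (_×_; _,_; proj₁; proj₂; ∃-syntax)
open import Induction.WellFounded using (Acc; acc)
open import Relation.Nullary using (¬_; yes; no)
open import Relation.Nullary.Decidable using (_×-dec_; decidable-stable)
open import Relation.Binary.PropositionalEquality using (_≡_; refl; sym)

∈-allSubsets : ∀ {n} (I : Subset n) → I ∈ᴸ allSubsets n
∈-allSubsets []                  = here refl
∈-allSubsets {suc n} (true ∷ I)  = ∈-++⁺ˡ (∈-map⁺ (true ∷_) (∈-allSubsets I))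
∈-allSubsets {suc n} (false ∷ I) =
  ∈-++⁺ʳ (map (true ∷_) (allSubsets n)) (∈-map⁺ (false ∷_) (∈-allSubsets I))

∩-monoʳ-⊆ : ∀ {n} (X : Subset n) {I J : Subset n} → I ⊆ J → X ∩ I ⊆ X ∩ J
∩-monoʳ-⊆ X {I} I⊆J x∈X∩I with x∈p∩q⁻ X I x∈X∩I
... | x∈X , x∈I = x∈p∩q⁺ (x∈X , I⊆J x∈I)

⊆∧⊄⇒≡ : ∀ {n} {p q : Subset n} → p ⊆ q → ¬ p ⊂ q → p ≡ q
⊆∧⊄⇒≡ {p = p} p⊆q p⊄q = ⊆-antisym p⊆q λ {x} x∈q →
  decidable-stable (x ∈? p) (λ x∉p → p⊄q (p⊆q , x , x∈q , x∉p))

module _ {n : ℕ} (𝓘 : Family n) (X : Subset n) where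

  private
    maxOver : List (Subset n) → ℕ
    maxOver = foldr (λ I m → if 𝓘 I then ∣ X ∩ I ∣ ⊔ m else m) 0

    ∣∩∣≤maxOver : ∀ {I} L → I ∈ᴸ L → I ∈F 𝓘 → ∣ X ∩ I ∣ ≤ maxOver L
    ∣∩∣≤maxOver (J ∷ L) (here refl) J∈𝓘 rewrite J∈𝓘 = m≤m⊔n _ _
    ∣∩∣≤maxOver (J ∷ L) (there I∈L) I∈𝓘 with 𝓘 J
    ... | true  = ≤-trans (∣∩∣≤maxOver L I∈L I∈𝓘) (m≤n⊔m _ _)
    ... | false = ∣∩∣≤maxOver L I∈L I∈𝓘

    maxOver-lub : ∀ {k} L → (∀ I → I ∈F 𝓘 → ∣ X ∩ I ∣ ≤ k) → maxOver L ≤ k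
    maxOver-lub []      bound = z≤n
    maxOver-lub (J ∷ L) bound with 𝓘 J in J∈𝓘
    ... | true  = ⊔-lub (bound J J∈𝓘) (maxOver-lub L bound)
    ... | false = maxOver-lub L bound

  ∣∩∣≤rank : ∀ {I} → I ∈F 𝓘 → ∣ X ∩ I ∣ ≤ rank 𝓘 X
  ∣∩∣≤rank {I} = ∣∩∣≤maxOver (allSubsets n) (∈-allSubsets I)

  rank-lub : ∀ {k} → (∀ I → I ∈F 𝓘 → ∣ X ∩ I ∣ ≤ k) → rank 𝓘 X ≤ k
  rank-lub = maxOver-lub (allSubsets n)

module _ {n : ℕ} (𝓘 : Family n) where

  maximal-if-⊄ : ∀ {I} → I ∈F 𝓘 → (∀ J → J ∈F 𝓘 → ¬ I ⊂ J) → Maximal 𝓘 I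
  maximal-if-⊄ I∈𝓘 ⊄ = I∈𝓘 , λ J J∈𝓘 I⊆J → sym (⊆∧⊄⇒≡ I⊆J (⊄ J J∈𝓘))

  extend-to-Maximal : ∀ {I} → I ∈F 𝓘 → ∃[ M ] (Maximal 𝓘 M × I ⊆ M)
  extend-to-Maximal {I} = go I (⊃-wellFounded I)
    where
    go : ∀ I → Acc _⊃_ I → I ∈F 𝓘 → ∃[ M ] (Maximal 𝓘 M × I ⊆ M)
    go I (acc larger) I∈𝓘 with anySubset? (λ J → (𝓘 J ≟ true) ×-dec (I ⊂? J))
    ... | no ∄J = I , maximal-if-⊄ I∈𝓘 (λ J J∈𝓘 I⊂J → ∄J (J , J∈𝓘 , I⊂J)) , ⊆-refl
    ... | yes (J , J∈𝓘 , I⊂J) with go J (larger I⊂J) J∈𝓘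
    ...   | M , M-max , J⊆M = M , M-max , ⊆-trans (p⊂q⇒p⊆q I⊂J) J⊆M

  rank-lub-Maximal : ∀ X {k} → (∀ M → Maximal 𝓘 M → ∣ X ∩ M ∣ ≤ k) → rank 𝓘 X ≤ k
  rank-lub-Maximal X bound = rank-lub 𝓘 X λ I I∈𝓘 →
    let M , M-max , I⊆M = extend-to-Maximal I∈𝓘
    in  ≤-trans (p⊆q⇒∣p∣≤∣q∣ (∩-monoʳ-⊆ X I⊆M)) (bound M M-max)

rank-mono-Maximal : ∀ {n} (𝓘 𝓘′ : Family n) → (∀ M → Maximal 𝓘′ M → Maximal 𝓘 M) →
                    ∀ X → rank 𝓘′ X ≤ rank 𝓘 X
rank-mono-Maximal 𝓘 𝓘′ Max′⊆Max X =
  rank-lub-Maximal 𝓘′ X λ M M-max′ → ∣∩∣≤rank 𝓘 X (proj₁ (Max′⊆Max M M-max′))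

proposition3p2 : (n : ℕ) → (𝓘 𝓘′ : Family (suc n)) →
    Constructible 𝓘 → Constructible 𝓘′ →
    (∀ I → (Maximal 𝓘 I → Maximal 𝓘′ I) × (Maximal 𝓘′ I → Maximal 𝓘 I)) →
    ∀ X → rank 𝓘′ X ≡ rank 𝓘 X
proposition3p2 n 𝓘 𝓘′ _ _ sameMaximal X =
  ≤-antisym (rank-mono-Maximal 𝓘 𝓘′ (λ M → proj₂ (sameMaximal M)) X)
            (rank-mono-Maximal 𝓘′ 𝓘 (λ M → proj₁ (sameMaximal M)) X)
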